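{- For every $n$, $$\mathrm{ex}(n,P_3,C_4)=\mathcal{N}(P_3,F(n))=\begin{cases}\binom{n}{2} & \text{if } n \text{ is odd},\\ \binom{n}{2}-1 & \text{if } n \text{ is even}.\end{cases}$$
   Context: $P_3$ is the path on $3$ vertices, $C_4$ the cycle on $4$ vertices. The friendship graph $F(n)$ is the $n$-vertex graph with a vertex of degree $n-1$ together with a matching of $\lfloor (n-1)/2\rfloor$ edges on the remaining $n-1$ vertices. $\mathcal{N}(H,G)$ is the number of subgraphs of $G$ isomorphic to $H$; $\mathrm{ex}(n,H,F)$ is the maximum of $\mathcal{N}(H,G)$ over $F$-free $n$-vertex graphs $G$. -}

module Defs where

open import Data.Nat using (ℕ; zero; suc; _+_; _∸_; _≡ᵇ_; _<ᵇ_; _/_; _%_; _≤_)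
open import Data.Nat.Combinatorics using (_C_)
open import Data.Bool using (Bool; true; false; if_then_else_; _∧_; _∨_; not)
open import Data.Fin using (Fin; toℕ)
open import Data.List using (List; map; allFin)
open import Data.Nat.ListAction using (sum)
open import Data.Product using (∃; _×_; Σ-syntax)
open import Relation.Binary.PropositionalEquality using (_≡_; _≢_; refl; cong₂; cong; trans)
open import Relation.Nullary using (¬_)

record Graph (n : ℕ) : Set where
  field
    adj   : Fin n → Fin n → Bool
    sym   : ∀ u v → adj u v ≡ adj v u
    irrefl : ∀ v → adj v v ≡ false
open Graph public

Σv : {n : ℕ} → (Fin n → ℕ) → ℕ
Σv {n} f = sum (map f (allFin n))

-- A copy of P₃ is
-- determined by its middle vertex v and the unordered pair {u, w} of its
-- end vertices (u ≠ w, both adjacent to v); we count triples (u, v, w)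
-- with u < w, u ~ v, v ~ w.  (u ≠ v, w ≠ v follow from looplessness.)
numP3 : {n : ℕ} → Graph n → ℕ
numP3 G = Σv λ u → Σv λ v → Σv λ w →
  if (toℕ u <ᵇ toℕ w) ∧ adj G u v ∧ adj G v w then 1 else 0

HasC4 : {n : ℕ} → Graph n → Set
HasC4 {n} G = ∃ λ (a : Fin n) → ∃ λ (b : Fin n) → ∃ λ (c : Fin n) → ∃ λ (d : Fin n) →
  (a ≢ b) × (a ≢ c) × (a ≢ d) × (b ≢ c) × (b ≢ d) × (c ≢ d) ×
  (adj G a b ≡ true) × (adj G b c ≡ true) × (adj G c d ≡ true) × (adj G d a ≡ true)

C4Free : {n : ℕ} → Graph n → Set
C4Free G = ¬ HasC4 G

ExP3C4 : ℕ → ℕ → Set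
ExP3C4 n m = (Σ[ G ∈ Graph n ] (C4Free G × numP3 G ≡ m))
           × (∀ (G : Graph n) → C4Free G → numP3 G ≤ m)

-- Friendship graph F(n): vertex 0 is adjacent to all others; the
-- matching on 1..n-1 pairs 2k-1 with 2k (k = 1 .. ⌊(n-1)/2⌋), i.e.
-- i, j ≥ 1 with i ≠ j are matched iff (i+1)/2 = (j+1)/2.
friendAdjℕ : ℕ → ℕ → Bool
friendAdjℕ i j =
  not (i ≡ᵇ j) ∧ ((i ≡ᵇ 0) ∨ (j ≡ᵇ 0) ∨ (((suc i) / 2) ≡ᵇ ((suc j) / 2)))

private
  ≡ᵇ-sym : ∀ i j → (i ≡ᵇ j) ≡ (j ≡ᵇ i)
  ≡ᵇ-sym zero zero = refl
  ≡ᵇ-sym zero (suc j) = refl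
  ≡ᵇ-sym (suc i) zero = refl
  ≡ᵇ-sym (suc i) (suc j) = ≡ᵇ-sym i j

  ≡ᵇ-refl : ∀ i → (i ≡ᵇ i) ≡ true
  ≡ᵇ-refl zero = refl
  ≡ᵇ-refl (suc i) = ≡ᵇ-refl i

  ∨-swap : ∀ a b c → (a ∨ b ∨ c) ≡ (b ∨ a ∨ c)
  ∨-swap false false c = refl
  ∨-swap false true c = refl
  ∨-swap true false c = refl
  ∨-swap true true c = refl

  friendAdjℕ-sym : ∀ i j → friendAdjℕ i j ≡ friendAdjℕ j i
  friendAdjℕ-sym i j with ≡ᵇ-sym i j | ≡ᵇ-sym ((suc i) / 2) ((suc j) / 2)
  ... | e1 | e2 = cong₂ (λ x y → not x ∧ y) e1
        (trans (∨-swap (i ≡ᵇ 0) (j ≡ᵇ 0) _) (cong (λ z → (j ≡ᵇ 0) ∨ (i ≡ᵇ 0) ∨ z) e2))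

  friendAdjℕ-irrefl : ∀ i → friendAdjℕ i i ≡ false
  friendAdjℕ-irrefl i rewrite ≡ᵇ-refl i = refl

F : (n : ℕ) → Graph n
F n = record
  { adj = λ u v → friendAdjℕ (toℕ u) (toℕ v)
  ; sym = λ u v → friendAdjℕ-sym (toℕ u) (toℕ v)
  ; irrefl = λ v → friendAdjℕ-irrefl (toℕ v)
  }

friendValue : ℕ → ℕ
friendValue n = if n % 2 ≡ᵇ 1 then n C 2 else (n C 2) ∸ 1

-- Write N(P₃, G) = Σ_{u<w} codeg(u, w).  In a C₄-free graph two distinct
-- vertices have at most one common neighbour, so N(P₃, G) ≤ C(n, 2).  When n
-- is even some pair has none: otherwise every pair has exactly one, so each
-- neighbourhood is perfectly matched and all degrees are even; counting walks
-- v – u – w then gives Σ_w codeg(v, w) = Σ_{u ~ v} deg u, which is even, but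
-- also equals (n − 1) + deg v, which is odd.  Conversely, in F(n) every pair
-- has a common neighbour (the centre, or a partner in the matching) except
-- {0, n − 1} when n is even.

module Submission where

open import Defs
open import Data.Nat using (ℕ; _≤_)
open import Data.Product using (_×_)
open import Relation.Binary.PropositionalEquality using (_≡_)

open import Data.Bool using (Bool; true; false; T; _∧_; if_then_else_)
open import Data.Bool.Properties using (∧-assoc; ∧-comm; ∧-idem; ∧-zeroʳ; T-≡)
open import Data.Empty using (⊥)
open import Data.Fin using (Fin; zero; suc; toℕ; fromℕ; fromℕ<; punchIn)
open import Data.Fin.Properties as Fin
  using (toℕ-injective; toℕ-fromℕ; toℕ-fromℕ<; toℕ<n; punchInᵢ≢i; any?)
open import Data.List using (tabulate) renaming (map to mapˡ)
open import Data.Nat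
  using (zero; suc; _+_; _*_; _∸_; _<_; _<ᵇ_; _≡ᵇ_; _/_; _%_; z≤n; s≤s; z<s; _<?_; _≟_)
open import Data.Nat.Combinatorics using (_C_; nC1≡n; nCk+nC[k+1]≡[n+1]C[k+1])
open import Data.Nat.DivMod
  using (m≡m%n+[m/n]*n; m%n<n; m*n%n≡0; [m+kn]%n≡m%n; m*n/n≡m; +-distrib-/-∣ʳ)
open import Data.Nat.Divisibility
  using (_∣_; _∣0; n∣m*n; m∣m*n; ∣n⇒∣m*n; ∣m∣n⇒∣m+n; ∣m+n∣m⇒∣n; ∣1⇒≡1)
open import Data.Nat.ListAction using () renaming (sum to sumˡ)
open import Data.Nat.Properties
open import Algebra.Properties.Semiring.Sum +-*-semiring
  using (sum; sum-syntax; ∑-comm; ∑-distrib-+; *-distribˡ-sum; sum-cong-≗; sum-remove;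
         sum-replicate-zero)
open import Data.Product using (∃; ∃₂; _,_)
open import Data.Sum using (_⊎_; inj₁; inj₂)
open import Function using (_∘_; id)
open import Function.Bundles using (Equivalence)
open import Relation.Binary.Definitions using (tri<; tri≈; tri>)
open import Relation.Binary.PropositionalEquality as ≡
  using (_≢_; refl; trans; cong; cong₂; subst; module ≡-Reasoning)
open import Relation.Nullary using (¬_; yes; no; contradiction)
open import Relation.Nullary.Decidable using (_×-dec_)

⟦_⟧ : Bool → ℕ
⟦ b ⟧ = if b then 1 else 0

⟦⟧≤1 : ∀ b → ⟦ b ⟧ ≤ 1
⟦⟧≤1 true = ≤-refl
⟦⟧≤1 false = z≤n

⟦∧⟧ : ∀ a b → ⟦ a ∧ b ⟧ ≡ ⟦ a ⟧ * ⟦ b ⟧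
⟦∧⟧ true b = ≡.sym (+-identityʳ ⟦ b ⟧)
⟦∧⟧ false _ = refl

T-∧⇒≡true : ∀ {a b} → T (a ∧ b) → (a ≡ true) × (b ≡ true)
T-∧⇒≡true {true} {true} _ = refl , refl

⟦⟧*≤⟦⟧ : ∀ b {c} → (T b → c ≤ 1) → ⟦ b ⟧ * c ≤ ⟦ b ⟧
⟦⟧*≤⟦⟧ true c≤1 = ≤-trans (≤-reflexive (+-identityʳ _)) (c≤1 _)
⟦⟧*≤⟦⟧ false _ = z≤n

⟦⟧≤⟦⟧* : ∀ b {c} → (T b → 1 ≤ c) → ⟦ b ⟧ ≤ ⟦ b ⟧ * c
⟦⟧≤⟦⟧* true 1≤c = ≤-trans (1≤c _) (≤-reflexive (≡.sym (+-identityʳ _)))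
⟦⟧≤⟦⟧* false _ = z≤n

⟦⟧*0<⟦⟧ : ∀ b → T b → ⟦ b ⟧ * 0 < ⟦ b ⟧
⟦⟧*0<⟦⟧ true _ = z<s

sumˡ-map-tabulate : ∀ {A : Set} {n} (f : A → ℕ) (g : Fin n → A) →
                    sumˡ (mapˡ f (tabulate g)) ≡ ∑[ i < n ] f (g i)
sumˡ-map-tabulate {n = zero} _ _ = refl
sumˡ-map-tabulate {n = suc n} f g = cong (f (g zero) +_) (sumˡ-map-tabulate f (g ∘ suc))

Σv≡sum : ∀ {n} (f : Fin n → ℕ) → Σv f ≡ sum f
Σv≡sum f = sumˡ-map-tabulate f id

Σv³≡∑³ : ∀ {n} (f : Fin n → Fin n → Fin n → ℕ) →
         (Σv λ u → Σv λ v → Σv λ w → f u v w) ≡ ∑[ u < n ] ∑[ v < n ] ∑[ w < n ] f u v w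
Σv³≡∑³ f = trans (Σv≡sum λ u → Σv λ v → Σv (f u v))
  (sum-cong-≗ λ u → trans (Σv≡sum λ v → Σv (f u v)) (sum-cong-≗ λ v → Σv≡sum (f u v)))

∑-one : ∀ n → ∑[ i < n ] 1 ≡ n
∑-one zero = refl
∑-one (suc n) = cong suc (∑-one n)

term≤∑ : ∀ {n} (f : Fin n → ℕ) i → f i ≤ sum f
term≤∑ f zero = m≤m+n _ _
term≤∑ f (suc i) = ≤-trans (term≤∑ (f ∘ suc) i) (m≤n+m _ _)

∑-mono-≤ : ∀ {n} {f g : Fin n → ℕ} → (∀ i → f i ≤ g i) → sum f ≤ sum g
∑-mono-≤ {zero} _ = z≤n
∑-mono-≤ {suc n} f≤g = +-mono-≤ (f≤g zero) (∑-mono-≤ (f≤g ∘ suc))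

∑-mono-< : ∀ {n} {f g : Fin n → ℕ} → (∀ i → f i ≤ g i) → ∀ a → f a < g a →
           sum f < sum g
∑-mono-< f≤g zero fa<ga = +-mono-<-≤ fa<ga (∑-mono-≤ (f≤g ∘ suc))
∑-mono-< f≤g (suc a) fa<ga = +-mono-≤-< (f≤g zero) (∑-mono-< (f≤g ∘ suc) a fa<ga)

∑-mono-≤-except : ∀ {n} {f g : Fin n → ℕ} a →
                  (∀ i → i ≢ a → g i ≤ f i) → g a ≤ suc (f a) → sum g ≤ suc (sum f)
∑-mono-≤-except zero g≤f ga≤ = +-mono-≤ ga≤ (∑-mono-≤ (λ i → g≤f (suc i) λ ()))
∑-mono-≤-except {f = f} (suc a) g≤f ga≤ = ≤-trans
  (+-mono-≤ (g≤f zero λ ()) (∑-mono-≤-except a (λ i i≢a → g≤f (suc i) (i≢a ∘ Fin.suc-injective)) ga≤))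
  (≤-reflexive (+-suc (f zero) _))

∑⟦⟧≤1 : ∀ {n} (p : Fin n → Bool) → (∀ i j → T (p i) → T (p j) → i ≡ j) →
        ∑[ i < n ] ⟦ p i ⟧ ≤ 1
∑⟦⟧≤1 {zero} _ _ = z≤n
∑⟦⟧≤1 {suc n} p unique with p zero in p0
... | false = ∑⟦⟧≤1 (p ∘ suc) λ i j pi pj → Fin.suc-injective (unique (suc i) (suc j) pi pj)
... | true = s≤s (≤-reflexive (trans (sum-cong-≗ rest-false) (sum-replicate-zero n)))
  where
  rest-false : ∀ i → ⟦ p (suc i) ⟧ ≡ 0
  rest-false i with p (suc i) in pi
  ... | false = refl
  ... | true = contradiction (unique zero (suc i) (subst T (≡.sym p0) _) (subst T (≡.sym pi) _))
                             λ ()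

∣-∑ : ∀ {d n} (f : Fin n → ℕ) → (∀ i → d ∣ f i) → d ∣ sum f
∣-∑ {d} {zero} _ _ = d ∣0
∣-∑ {n = suc n} f d∣f = ∣m∣n⇒∣m+n (d∣f zero) (∣-∑ (f ∘ suc) (d∣f ∘ suc))

2∣∑∑-symmetric : ∀ {n} (g : Fin n → Fin n → ℕ) →
                 (∀ x y → g x y ≡ g y x) → (∀ x → g x x ≡ 0) → 2 ∣ ∑[ x < n ] ∑[ y < n ] g x y
2∣∑∑-symmetric {zero} _ _ _ = 2 ∣0
2∣∑∑-symmetric {suc n} g g-sym g-diag = subst (2 ∣_) (≡.sym split) (∣m∣n⇒∣m+n (m∣m*n R) 2∣E)
  where
  R = ∑[ y < n ] g zero (suc y)
  E = ∑[ x < n ] ∑[ y < n ] g (suc x) (suc y)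
  2∣E : 2 ∣ E
  2∣E = 2∣∑∑-symmetric (λ x y → g (suc x) (suc y)) (λ x y → g-sym (suc x) (suc y)) (g-diag ∘ suc)
  open ≡-Reasoning
  split : ∑[ x < suc n ] ∑[ y < suc n ] g x y ≡ 2 * R + E
  split = begin
    (g zero zero + R) + ∑[ x < n ] (g (suc x) zero + ∑[ y < n ] g (suc x) (suc y))
      ≡⟨ cong₂ _+_ (cong (_+ R) (g-diag zero)) (∑-distrib-+ (λ x → g (suc x) zero) _) ⟩
    R + (∑[ x < n ] g (suc x) zero + E)
      ≡⟨ cong (λ t → R + (t + E)) (sum-cong-≗ (λ x → g-sym (suc x) zero)) ⟩
    R + (R + E)
      ≡⟨ +-assoc R R E ⟨
    R + R + E
      ≡⟨ cong (λ t → R + t + E) (+-identityʳ R) ⟨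
    2 * R + E ∎

∑-one-except : ∀ {n} (f : Fin n → ℕ) a → (∀ i → i ≢ a → f i ≡ 1) → sum f + 1 ≡ n + f a
∑-one-except {suc n} f a ones = begin
  sum f + 1                            ≡⟨ cong (_+ 1) (sum-remove f) ⟩
  f a + ∑[ i < n ] f (punchIn a i) + 1 ≡⟨ cong (λ t → f a + t + 1) rest ⟩
  f a + n + 1                          ≡⟨ +-comm (f a + n) 1 ⟩
  suc (f a + n)                        ≡⟨ cong suc (+-comm (f a) n) ⟩
  suc n + f a                          ∎
  where
  open ≡-Reasoning
  rest : ∑[ i < n ] f (punchIn a i) ≡ n
  rest = trans (sum-cong-≗ λ i → ones (punchIn a i) (punchInᵢ≢i a i)) (∑-one n)

∑∑⟦<⟧≡C2 : ∀ n → ∑[ u < n ] ∑[ w < n ] ⟦ toℕ u <ᵇ toℕ w ⟧ ≡ n C 2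
∑∑⟦<⟧≡C2 zero = refl
∑∑⟦<⟧≡C2 (suc n) = begin
  ∑[ w < n ] 1 + ∑[ u < n ] ∑[ w < n ] ⟦ toℕ u <ᵇ toℕ w ⟧
    ≡⟨ cong₂ _+_ (∑-one n) (∑∑⟦<⟧≡C2 n) ⟩
  n + n C 2     ≡⟨ cong (_+ n C 2) (nC1≡n n) ⟨
  n C 1 + n C 2 ≡⟨ nCk+nC[k+1]≡[n+1]C[k+1] n 1 ⟩
  suc n C 2     ∎
  where open ≡-Reasoning

data Parity : ℕ → Set where
  even : ∀ k → Parity (k * 2)
  odd  : ∀ k → Parity (suc (k * 2))

parity : ∀ n → Parity n
parity zero = even 0
parity (suc n) with parity n
... | even k = odd k
... | odd k = even (suc k)

odd⇒∤2 : ∀ k → ¬ 2 ∣ suc (k * 2)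
odd⇒∤2 k 2∣odd = contradiction (∣1⇒≡1 2∣1) λ ()
  where
  2∣1 : 2 ∣ 1
  2∣1 = ∣m+n∣m⇒∣n (subst (2 ∣_) (+-comm 1 (k * 2)) 2∣odd) (n∣m*n k)

%2≡0⊎1 : ∀ a → a % 2 ≡ 0 ⊎ a % 2 ≡ 1
%2≡0⊎1 a with a % 2 | m%n<n a 2
... | 0 | _ = inj₁ refl
... | 1 | _ = inj₂ refl
... | suc (suc _) | s≤s (s≤s ())

%2-alternating : ∀ a b c → a % 2 ≢ b % 2 → b % 2 ≢ c % 2 → a % 2 ≡ c % 2
%2-alternating a b c a≢b b≢c with %2≡0⊎1 a | %2≡0⊎1 b | %2≡0⊎1 c
... | inj₁ a0 | inj₁ b0 | _       = contradiction (trans a0 (≡.sym b0)) a≢b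
... | inj₂ a1 | inj₂ b1 | _       = contradiction (trans a1 (≡.sym b1)) a≢b
... | _       | inj₁ b0 | inj₁ c0 = contradiction (trans b0 (≡.sym c0)) b≢c
... | _       | inj₂ b1 | inj₂ c1 = contradiction (trans b1 (≡.sym c1)) b≢c
... | inj₁ a0 | inj₂ _  | inj₁ c0 = trans a0 (≡.sym c0)
... | inj₂ a1 | inj₁ _  | inj₂ c1 = trans a1 (≡.sym c1)

≡-from-/2-%2 : ∀ a b → a / 2 ≡ b / 2 → a % 2 ≡ b % 2 → a ≡ b
≡-from-/2-%2 a b a/2≡b/2 a%2≡b%2 = begin
  a                 ≡⟨ m≡m%n+[m/n]*n a 2 ⟩
  a % 2 + a / 2 * 2 ≡⟨ cong₂ (λ r q → r + q * 2) a%2≡b%2 a/2≡b/2 ⟩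
  b % 2 + b / 2 * 2 ≡⟨ m≡m%n+[m/n]*n b 2 ⟨
  b                 ∎
  where open ≡-Reasoning

/2-pigeonhole : ∀ {a b c} → a ≢ b → b ≢ c → a / 2 ≡ b / 2 → b / 2 ≡ c / 2 → a ≡ c
/2-pigeonhole {a} {b} {c} a≢b b≢c a~b b~c = ≡-from-/2-%2 a c (trans a~b b~c)
  (%2-alternating a b c (a≢b ∘ ≡-from-/2-%2 a b a~b) (b≢c ∘ ≡-from-/2-%2 b c b~c))

odd/2 : ∀ q → suc (q * 2) / 2 ≡ q
odd/2 q = trans (+-distrib-/-∣ʳ 1 (n∣m*n q {2})) (m*n/n≡m q 2)

module _ {n : ℕ} (G : Graph n) where

  deg : Fin n → ℕ
  deg u = ∑[ v < n ] ⟦ adj G u v ⟧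

  codeg : Fin n → Fin n → ℕ
  codeg u w = ∑[ v < n ] ⟦ adj G u v ∧ adj G v w ⟧

  Friendship : Set
  Friendship = ∀ {u w} → u ≢ w → codeg u w ≡ 1

  numP3≡∑codeg : numP3 G ≡ ∑[ u < n ] ∑[ w < n ] (⟦ toℕ u <ᵇ toℕ w ⟧ * codeg u w)
  numP3≡∑codeg = begin
    numP3 G
      ≡⟨ Σv³≡∑³ (λ u v w → ⟦ (toℕ u <ᵇ toℕ w) ∧ adj G u v ∧ adj G v w ⟧) ⟩
    ∑[ u < n ] ∑[ v < n ] ∑[ w < n ] ⟦ (toℕ u <ᵇ toℕ w) ∧ adj G u v ∧ adj G v w ⟧
      ≡⟨ sum-cong-≗ (λ u → ∑-comm λ v w →
           ⟦ (toℕ u <ᵇ toℕ w) ∧ adj G u v ∧ adj G v w ⟧) ⟩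
    ∑[ u < n ] ∑[ w < n ] ∑[ v < n ] ⟦ (toℕ u <ᵇ toℕ w) ∧ adj G u v ∧ adj G v w ⟧
      ≡⟨ sum-cong-≗ (λ u → sum-cong-≗ λ w →
           trans (sum-cong-≗ λ v → ⟦∧⟧ (toℕ u <ᵇ toℕ w) (adj G u v ∧ adj G v w))
                 (≡.sym (*-distribˡ-sum ⟦ toℕ u <ᵇ toℕ w ⟧ λ v → ⟦ adj G u v ∧ adj G v w ⟧))) ⟩
    ∑[ u < n ] ∑[ w < n ] (⟦ toℕ u <ᵇ toℕ w ⟧ * codeg u w) ∎
    where open ≡-Reasoning

  adj⇒≢ : ∀ {u v} → adj G u v ≡ true → u ≢ v
  adj⇒≢ {u} uv refl = contradiction (trans (≡.sym uv) (irrefl G u)) λ ()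

  codeg-sym : ∀ u w → codeg u w ≡ codeg w u
  codeg-sym u w = sum-cong-≗ λ v →
    cong ⟦_⟧ (trans (∧-comm (adj G u v) _) (cong₂ _∧_ (Graph.sym G v w) (Graph.sym G u v)))

  codeg-self : ∀ v → codeg v v ≡ deg v
  codeg-self v = sum-cong-≗ λ u →
    cong ⟦_⟧ (trans (cong (adj G v u ∧_) (Graph.sym G u v)) (∧-idem _))

  ∑codeg≡∑deg : ∀ v → ∑[ w < n ] codeg v w ≡ ∑[ u < n ] (⟦ adj G v u ⟧ * deg u)
  ∑codeg≡∑deg v = trans (∑-comm λ w u → ⟦ adj G v u ∧ adj G u w ⟧) (sum-cong-≗ λ u →
    trans (sum-cong-≗ λ w → ⟦∧⟧ (adj G v u) (adj G u w))
          (≡.sym (*-distribˡ-sum ⟦ adj G v u ⟧ (λ w → ⟦ adj G u w ⟧))))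

  C4Free⇒codeg≤1 : C4Free G → ∀ {u w} → u ≢ w → codeg u w ≤ 1
  C4Free⇒codeg≤1 free {u} {w} u≢w = ∑⟦⟧≤1 _ unique
    where
    unique : ∀ x y → T (adj G u x ∧ adj G x w) → T (adj G u y ∧ adj G y w) → x ≡ y
    unique x y ux∧xw uy∧yw with x Fin.≟ y | T-∧⇒≡true ux∧xw | T-∧⇒≡true uy∧yw
    ... | yes x≡y | _ | _ = x≡y
    ... | no x≢y | ux , xw | uy , yw = contradiction
      ( u , x , w , y , adj⇒≢ ux , u≢w , adj⇒≢ uy , adj⇒≢ xw , x≢y , adj⇒≢ wy
      , ux , xw , wy , trans (Graph.sym G y u) uy ) free
      where
      wy : adj G w y ≡ true
      wy = trans (Graph.sym G w y) yw

  Friendship⇒deg-even : Friendship → ∀ u → 2 ∣ deg u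
  Friendship⇒deg-even friendship u =
    subst (2 ∣_) (≡.sym deg≡∑∑) (2∣∑∑-symmetric triangle triangle-sym triangle-diag)
    where
    triangle : Fin n → Fin n → ℕ
    triangle x z = ⟦ adj G u x ∧ adj G u z ∧ adj G z x ⟧
    triangle-sym : ∀ x z → triangle x z ≡ triangle z x
    triangle-sym x z = cong ⟦_⟧ (begin
      adj G u x ∧ adj G u z ∧ adj G z x   ≡⟨ ∧-assoc (adj G u x) _ _ ⟨
      (adj G u x ∧ adj G u z) ∧ adj G z x ≡⟨ cong₂ _∧_ (∧-comm (adj G u x) _) (Graph.sym G z x) ⟩
      (adj G u z ∧ adj G u x) ∧ adj G x z ≡⟨ ∧-assoc (adj G u z) _ _ ⟩
      adj G u z ∧ adj G u x ∧ adj G x z   ∎)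
      where open ≡-Reasoning
    triangle-diag : ∀ x → triangle x x ≡ 0
    triangle-diag x = cong ⟦_⟧ (trans (cong (λ b → adj G u x ∧ adj G u x ∧ b) (irrefl G x))
                                      (trans (cong (adj G u x ∧_) (∧-zeroʳ _)) (∧-zeroʳ _)))
    ⟦adj⟧≡⟦adj⟧*codeg : ∀ x → ⟦ adj G u x ⟧ ≡ ⟦ adj G u x ⟧ * codeg u x
    ⟦adj⟧≡⟦adj⟧*codeg x with adj G u x in ux
    ... | false = refl
    ... | true = ≡.sym (trans (*-identityˡ _) (friendship (adj⇒≢ ux)))
    deg≡∑∑ : deg u ≡ ∑[ x < n ] ∑[ z < n ] triangle x z
    deg≡∑∑ = sum-cong-≗ λ x → begin
      ⟦ adj G u x ⟧
        ≡⟨ ⟦adj⟧≡⟦adj⟧*codeg x ⟩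
      ⟦ adj G u x ⟧ * codeg u x
        ≡⟨ *-distribˡ-sum ⟦ adj G u x ⟧ (λ z → ⟦ adj G u z ∧ adj G z x ⟧) ⟩
      ∑[ z < n ] (⟦ adj G u x ⟧ * ⟦ adj G u z ∧ adj G z x ⟧)
        ≡⟨ sum-cong-≗ (λ z → ⟦∧⟧ (adj G u x) (adj G u z ∧ adj G z x)) ⟨
      ∑[ z < n ] triangle x z ∎
      where open ≡-Reasoning

  Friendship⇒odd : Friendship → Fin n → ¬ 2 ∣ n
  Friendship⇒odd friendship v 2∣n = contradiction (∣1⇒≡1 2∣1) λ ()
    where
    2∣deg : ∀ u → 2 ∣ deg u
    2∣deg = Friendship⇒deg-even friendship
    2∣∑codeg : 2 ∣ ∑[ w < n ] codeg v w
    2∣∑codeg = subst (2 ∣_) (≡.sym (∑codeg≡∑deg v))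
                     (∣-∑ _ λ u → ∣n⇒∣m*n ⟦ adj G v u ⟧ (2∣deg u))
    ∑codeg+1≡n+deg : ∑[ w < n ] codeg v w + 1 ≡ n + deg v
    ∑codeg+1≡n+deg = trans (∑-one-except (codeg v) v λ w w≢v → friendship (w≢v ∘ ≡.sym))
                           (cong (n +_) (codeg-self v))
    2∣1 : 2 ∣ 1
    2∣1 = ∣m+n∣m⇒∣n (subst (2 ∣_) (≡.sym ∑codeg+1≡n+deg) (∣m∣n⇒∣m+n 2∣n (2∣deg v)))
                    2∣∑codeg

  C4Free⇒⟦<⟧*codeg≤⟦<⟧ : C4Free G → ∀ u w →
                         ⟦ toℕ u <ᵇ toℕ w ⟧ * codeg u w ≤ ⟦ toℕ u <ᵇ toℕ w ⟧
  C4Free⇒⟦<⟧*codeg≤⟦<⟧ free u w =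
    ⟦⟧*≤⟦⟧ (toℕ u <ᵇ toℕ w) λ u<w →
      C4Free⇒codeg≤1 free (<⇒≢ (<ᵇ⇒< (toℕ u) (toℕ w) u<w) ∘ cong toℕ)

  numP3≤C2 : C4Free G → numP3 G ≤ n C 2
  numP3≤C2 free = begin
    numP3 G                                                 ≡⟨ numP3≡∑codeg ⟩
    ∑[ u < n ] ∑[ w < n ] (⟦ toℕ u <ᵇ toℕ w ⟧ * codeg u w) ≤⟨ ∑-mono-≤ (∑-mono-≤ ∘ term≤) ⟩
    ∑[ u < n ] ∑[ w < n ] ⟦ toℕ u <ᵇ toℕ w ⟧                ≡⟨ ∑∑⟦<⟧≡C2 n ⟩
    n C 2                                                   ∎
    where
    open ≤-Reasoning
    term≤ = C4Free⇒⟦<⟧*codeg≤⟦<⟧ free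

  numP3<C2 : C4Free G → ∀ {u w} → toℕ u < toℕ w → codeg u w ≡ 0 → numP3 G < n C 2
  numP3<C2 free {u} {w} u<w codeg≡0 = begin-strict
    numP3 G                                                 ≡⟨ numP3≡∑codeg ⟩
    ∑[ u < n ] ∑[ w < n ] (⟦ toℕ u <ᵇ toℕ w ⟧ * codeg u w) <⟨ ∑-mono-< (∑-mono-≤ ∘ term≤) u row< ⟩
    ∑[ u < n ] ∑[ w < n ] ⟦ toℕ u <ᵇ toℕ w ⟧                ≡⟨ ∑∑⟦<⟧≡C2 n ⟩
    n C 2                                                   ∎
    where
    open ≤-Reasoning
    term≤ = C4Free⇒⟦<⟧*codeg≤⟦<⟧ free
    term< : ⟦ toℕ u <ᵇ toℕ w ⟧ * codeg u w < ⟦ toℕ u <ᵇ toℕ w ⟧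
    term< = subst (λ c → ⟦ toℕ u <ᵇ toℕ w ⟧ * c < ⟦ toℕ u <ᵇ toℕ w ⟧) (≡.sym codeg≡0)
                  (⟦⟧*0<⟦⟧ _ (<⇒<ᵇ u<w))
    row< : ∑[ w′ < n ] (⟦ toℕ u <ᵇ toℕ w′ ⟧ * codeg u w′) <
           ∑[ w′ < n ] ⟦ toℕ u <ᵇ toℕ w′ ⟧
    row< = ∑-mono-< (term≤ u) w term<

  C4Free⇒pair-without-common-neighbour : C4Free G → 2 ∣ n → Fin n →
                                         ∃₂ λ u w → toℕ u < toℕ w × codeg u w ≡ 0
  C4Free⇒pair-without-common-neighbour free 2∣n v
    with any? (λ u → any? (λ w → (toℕ u <? toℕ w) ×-dec (codeg u w ≟ 0)))
  ... | yes (u , w , found) = u , w , found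
  ... | no none = contradiction 2∣n (Friendship⇒odd friendship v)
    where
    codeg≡1 : ∀ {u w} → toℕ u < toℕ w → codeg u w ≡ 1
    codeg≡1 {u} {w} u<w = ≤-antisym (C4Free⇒codeg≤1 free (<⇒≢ u<w ∘ cong toℕ))
                                    (n≢0⇒n>0 λ codeg≡0 → none (u , w , u<w , codeg≡0))
    friendship : Friendship
    friendship {u} {w} u≢w with <-cmp (toℕ u) (toℕ w)
    ... | tri< u<w _ _ = codeg≡1 u<w
    ... | tri≈ _ u≡w _ = contradiction (toℕ-injective u≡w) u≢w
    ... | tri> _ _ w<u = trans (codeg-sym u w) (codeg≡1 w<u)

friendValue-even : ∀ k → friendValue (k * 2) ≡ (k * 2) C 2 ∸ 1
friendValue-even k with k * 2 % 2 | m*n%n≡0 k 2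
... | _ | refl = refl

friendValue-odd : ∀ k → friendValue (suc (k * 2)) ≡ suc (k * 2) C 2
friendValue-odd k with suc (k * 2) % 2 | [m+kn]%n≡m%n 1 k 2
... | _ | refl = refl

numP3≤friendValue : ∀ {n} → 1 ≤ n → (G : Graph n) → C4Free G → numP3 G ≤ friendValue n
numP3≤friendValue {n} 1≤n G free with parity n
... | odd k rewrite friendValue-odd k = numP3≤C2 G free
... | even k rewrite friendValue-even k
  with C4Free⇒pair-without-common-neighbour G free (n∣m*n k) (fromℕ< 1≤n)
... | u , w , u<w , codeg≡0 = ∸-monoˡ-≤ 1 (numP3<C2 G free u<w codeg≡0)

infix 4 _~_
_~_ : ℕ → ℕ → Set
i ~ j = friendAdjℕ i j ≡ true

~-suc⇒ : ∀ {x y} → suc x ~ suc y → x ≢ y × suc (suc x) / 2 ≡ suc (suc y) / 2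
~-suc⇒ {x} {y} x~y with x ≡ᵇ y in x≡ᵇy | x~y
... | false | halves = (λ x≡y → subst T x≡ᵇy (≡⇒≡ᵇ x y x≡y)) , ≡ᵇ⇒≡ _ _ (subst T (≡.sym halves) _)

~-suc⇐ : ∀ {x y} → x ≢ y → suc (suc x) / 2 ≡ suc (suc y) / 2 → suc x ~ suc y
~-suc⇐ {x} {y} x≢y halves with x ≡ᵇ y in x≡ᵇy
... | true = contradiction (≡ᵇ⇒≡ x y (subst T (≡.sym x≡ᵇy) _)) x≢y
... | false = Equivalence.to T-≡ (≡⇒≡ᵇ _ _ halves)

odd~even : ∀ q → suc (q * 2) ~ suc (suc (q * 2))
odd~even q = ~-suc⇐ {q * 2} (1+n≢n ∘ ≡.sym) (trans (m*n/n≡m (suc q) 2) (≡.sym (odd/2 (suc q))))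

even~odd : ∀ q → suc (suc (q * 2)) ~ suc (q * 2)
even~odd q = ~-suc⇐ {suc (q * 2)} 1+n≢n (trans (odd/2 (suc q)) (≡.sym (m*n/n≡m (suc q) 2)))

~-suc-unique : ∀ {x y z} → suc x ~ suc y → suc y ~ suc z → x ≡ z
~-suc-unique x~y y~z with ~-suc⇒ x~y | ~-suc⇒ y~z
... | x≢y , x/2≡y/2 | y≢z , y/2≡z/2 =
  suc-suc-injective (/2-pigeonhole (x≢y ∘ suc-suc-injective) (y≢z ∘ suc-suc-injective) x/2≡y/2 y/2≡z/2)
  where
  suc-suc-injective : ∀ {a b} → suc (suc a) ≡ suc (suc b) → a ≡ b
  suc-suc-injective = suc-injective ∘ suc-injective

-- Three consecutive vertices of a 4-cycle are nonzero, and then the middle one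
-- would have two partners in the matching.
~-no-C4 : ∀ a b c d → a ≢ c → b ≢ d → a ~ b → b ~ c → c ~ d → d ~ a → ⊥
~-no-C4 zero    zero    _       _       _   _   () _  _  _
~-no-C4 zero    (suc b) zero    _       a≢c _   _  _  _  _  = a≢c refl
~-no-C4 zero    (suc b) (suc c) zero    _   _   _  _  _  ()
~-no-C4 zero    (suc b) (suc c) (suc d) _   b≢d _  bc cd _  = b≢d (cong suc (~-suc-unique bc cd))
~-no-C4 (suc a) zero    zero    _       _   _   _  () _  _
~-no-C4 (suc a) zero    (suc c) zero    _   b≢d _  _  _  _  = b≢d refl
~-no-C4 (suc a) zero    (suc c) (suc d) a≢c _   _  _  cd da = a≢c (cong suc (≡.sym (~-suc-unique cd da)))
~-no-C4 (suc a) (suc b) zero    zero    _   _   _  _  () _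
~-no-C4 (suc a) (suc b) zero    (suc d) _   b≢d ab _  _  da = b≢d (cong suc (≡.sym (~-suc-unique da ab)))
~-no-C4 (suc a) (suc b) (suc c) _       a≢c _   ab bc _  _  = a≢c (cong suc (~-suc-unique ab bc))

F-C4Free : ∀ n → C4Free (F n)
F-C4Free n (a , b , c , d , _ , a≢c , _ , _ , b≢d , _ , ab , bc , cd , da) =
  ~-no-C4 (toℕ a) (toℕ b) (toℕ c) (toℕ d) (a≢c ∘ toℕ-injective) (b≢d ∘ toℕ-injective) ab bc cd da

F-common-neighbour : ∀ {n i j} → i < j → j < n → (i ≡ 0 → suc j ≡ n → ¬ 2 ∣ n) →
                     ∃ λ x → x < n × i ~ x × x ~ j
F-common-neighbour {i = suc _} {suc _} _ j<n _ = 0 , ≤-trans (s≤s z≤n) j<n , refl , refl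
F-common-neighbour {n} {zero} {suc j} _ j<n exception with parity j
... | odd q = suc (q * 2) , <-trans (n<1+n _) j<n , refl , odd~even q
... | even q with m≤n⇒m<n∨m≡n j<n
...   | inj₁ partner<n = suc (suc (q * 2)) , partner<n , refl , even~odd q
...   | inj₂ partner≡n =
  contradiction (subst (2 ∣_) partner≡n (n∣m*n (suc q))) (exception refl partner≡n)

F-codeg-positive : ∀ {n} {u w : Fin n} → toℕ u < toℕ w →
                   (toℕ u ≡ 0 → suc (toℕ w) ≡ n → ¬ 2 ∣ n) → 1 ≤ codeg (F n) u w
F-codeg-positive {n} {u} {w} u<w exception with F-common-neighbour u<w (toℕ<n w) exception
... | x , x<n , u~x , x~w =
  ≤-trans (≤-reflexive (≡.sym (cong₂ (λ a b → ⟦ a ∧ b ⟧) u~x′ x~w′))) (term≤∑ _ (fromℕ< x<n))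
  where
  u~x′ : toℕ u ~ toℕ (fromℕ< x<n)
  u~x′ = subst (toℕ u ~_) (≡.sym (toℕ-fromℕ< x<n)) u~x
  x~w′ : toℕ (fromℕ< x<n) ~ toℕ w
  x~w′ = subst (_~ toℕ w) (≡.sym (toℕ-fromℕ< x<n)) x~w

C2≤numP3-F-odd : ∀ k → suc (k * 2) C 2 ≤ numP3 (F (suc (k * 2)))
C2≤numP3-F-odd k = begin
  n C 2
    ≡⟨ ∑∑⟦<⟧≡C2 n ⟨
  ∑[ u < n ] ∑[ w < n ] ⟦ toℕ u <ᵇ toℕ w ⟧
    ≤⟨ ∑-mono-≤ (λ u → ∑-mono-≤ λ w → ⟦⟧≤⟦⟧* _ (pair-covered u w)) ⟩
  ∑[ u < n ] ∑[ w < n ] (⟦ toℕ u <ᵇ toℕ w ⟧ * codeg (F n) u w)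
    ≡⟨ numP3≡∑codeg (F n) ⟨
  numP3 (F n) ∎
  where
  open ≤-Reasoning
  n = suc (k * 2)
  pair-covered : ∀ u w → T (toℕ u <ᵇ toℕ w) → 1 ≤ codeg (F n) u w
  pair-covered u w u<w = F-codeg-positive (<ᵇ⇒< (toℕ u) (toℕ w) u<w) λ _ _ → odd⇒∤2 k

C2≤1+numP3-F : ∀ m → suc m C 2 ≤ suc (numP3 (F (suc m)))
C2≤1+numP3-F m = begin
  n C 2
    ≡⟨ ∑∑⟦<⟧≡C2 n ⟨
  ∑[ u < n ] ∑[ w < n ] ⟦ toℕ u <ᵇ toℕ w ⟧
    ≤⟨ ∑-mono-≤-except zero other-rows first-row ⟩
  suc (∑[ u < n ] ∑[ w < n ] (⟦ toℕ u <ᵇ toℕ w ⟧ * codeg (F n) u w))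
    ≡⟨ cong suc (numP3≡∑codeg (F n)) ⟨
  suc (numP3 (F n)) ∎
  where
  open ≤-Reasoning
  n = suc m
  other-rows : ∀ u → u ≢ zero →
               ∑[ w < n ] ⟦ toℕ u <ᵇ toℕ w ⟧ ≤ ∑[ w < n ] (⟦ toℕ u <ᵇ toℕ w ⟧ * codeg (F n) u w)
  other-rows u u≢0 = ∑-mono-≤ λ w → ⟦⟧≤⟦⟧* _ λ u<w →
    F-codeg-positive (<ᵇ⇒< (toℕ u) (toℕ w) u<w) λ u≡0 _ → contradiction (toℕ-injective u≡0) u≢0
  first-row : ∑[ w < n ] ⟦ 0 <ᵇ toℕ w ⟧ ≤ suc (∑[ w < n ] (⟦ 0 <ᵇ toℕ w ⟧ * codeg (F n) zero w))
  first-row = ∑-mono-≤-except {f = λ w → ⟦ 0 <ᵇ toℕ w ⟧ * codeg (F n) zero w} (fromℕ m)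
    (λ w w≢m → ⟦⟧≤⟦⟧* _ λ 0<w → F-codeg-positive (<ᵇ⇒< 0 (toℕ w) 0<w) λ _ 1+w≡n →
      contradiction (toℕ-injective (trans (suc-injective 1+w≡n) (≡.sym (toℕ-fromℕ m)))) w≢m)
    (≤-trans (⟦⟧≤1 _) (s≤s z≤n))

friendValue≤numP3-F : ∀ n → friendValue n ≤ numP3 (F n)
friendValue≤numP3-F n with parity n
... | odd k = subst (_≤ numP3 (F (suc (k * 2)))) (≡.sym (friendValue-odd k)) (C2≤numP3-F-odd k)
... | even zero = z≤n
... | even (suc k) = subst (_≤ numP3 (F (suc k * 2))) (≡.sym (friendValue-even (suc k)))
                           (m≤n+o⇒m∸n≤o _ 1 (C2≤1+numP3-F (suc (k * 2))))

proposition3p1 : (n : ℕ) → 1 ≤ n →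
    ExP3C4 n (numP3 (F n)) × (numP3 (F n) ≡ friendValue n)
proposition3p1 n 1≤n =
  ((F n , F-C4Free n , refl) , λ G free → ≤-trans (upper G free) lower) ,
  ≤-antisym (upper (F n) (F-C4Free n)) lower
  where
  upper : (G : Graph n) → C4Free G → numP3 G ≤ friendValue n
  upper = numP3≤friendValue 1≤n
  lower : friendValue n ≤ numP3 (F n)
  lower = friendValue≤numP3-F n
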